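{- Let $n$ be a positive integer. The tripod nim position $(n,(n,n,n))$, in which the center and all three leaves have size $n$, is a $\mathcal{P}$-position if and only if $n$ is one less than a power of two.
   Context: Tree nim: a position is a finite tree whose vertices carry positive integer sizes; a leaf is a vertex of degree at most $1$; a move chooses a leaf and decreases its size by a positive integer, deleting that vertex if its size becomes $0$ (so inner vertices become playable once they become leaves); normal play (the player unable to move loses). A position is $\mathcal{P}$ iff no move leads to a $\mathcal{P}$-position. Tripod nim: $(o,(a,b,c))$ denotes the position consisting of a central vertex of size $o$ adjacent to three leaves of sizes $a$, $b$, $c$. -}

module Defs where

open import Data.Nat using (ℕ; zero; suc; _<_; _≤_)
open import Data.List using (List; []; _∷_)
open import Data.Maybe using (Maybe; just; nothing)
open import Data.Product using (Σ; _×_)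

-- A finite tree with vertex sizes, represented as a rooted rose tree
-- (the choice of root is only a representation device; the game is on the
-- underlying unrooted tree).  node s ts : vertex of size s with children ts.
-- Legal positions have all sizes positive.
data Tree : Set where
  node : ℕ → List Tree → Tree

-- A position is a tree, or the empty position (all vertices deleted).
Pos : Set
Pos = Maybe Tree

-- Degree of a vertex in the unrooted tree: a non-root vertex has degree
-- 1 + (number of children), so it is a leaf iff it has no children; the root
-- has degree = number of children, so it is a leaf iff it has at most one child.

mutual
  -- A move at a leaf strictly inside the subtree rooted at a NON-root vertex.
  -- Result nothing = that vertex was deleted (only possible for a leaf).
  data SubMove : Tree → Maybe Tree → Set where
    leaf-shrink : ∀ {s s'} → 1 ≤ s' → s' < s →
                  SubMove (node s []) (just (node s' []))
    leaf-delete : ∀ {s} → SubMove (node s []) nothing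
    deeper      : ∀ {s ts ts'} → ChildMove ts ts' →
                  SubMove (node s ts) (just (node s ts'))

  data ChildMove : List Tree → List Tree → Set where
    here     : ∀ {t t' ts} → SubMove t (just t') → ChildMove (t ∷ ts) (t' ∷ ts)
    here-del : ∀ {t ts} → SubMove t nothing → ChildMove (t ∷ ts) ts
    there    : ∀ {t ts ts'} → ChildMove ts ts' → ChildMove (t ∷ ts) (t ∷ ts')

data Move : Pos → Pos → Set where
  inner        : ∀ {s ts ts'} → ChildMove ts ts' →
                 Move (just (node s ts)) (just (node s ts'))
  root-shrink0 : ∀ {s s'} → 1 ≤ s' → s' < s →
                 Move (just (node s [])) (just (node s' []))
  root-shrink1 : ∀ {s s' t} → 1 ≤ s' → s' < s →
                 Move (just (node s (t ∷ []))) (just (node s' (t ∷ [])))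
  root-delete0 : ∀ {s} → Move (just (node s [])) nothing
  root-delete1 : ∀ {s t} → Move (just (node s (t ∷ []))) (just t)

-- Since every move strictly decreases
-- the total size, every position is exactly one of these.
mutual
  data IsP (p : Pos) : Set where
    allN : (∀ q → Move p q → IsN q) → IsP p

  data IsN (p : Pos) : Set where
    someP : ∀ q → Move p q → IsP q → IsN p

tripod : ℕ → ℕ → ℕ → ℕ → Pos
tripod o a b c = just (node o (node a [] ∷ node b [] ∷ node c [] ∷ []))

{-# OPTIONS --safe #-}
-- Write n = (2^j − 1) + 2^j · 2u, so that j is the number of trailing 1-bits of n, and put
-- m = n if u = 0 and m = 2^j otherwise. The centre of a tripod cannot move, and deleting a leaf
-- leaves a path x — n — y, which is P iff x = y ≠ n. With this, one checks as for three-heap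
-- nim that among the tripods with centre n and leaves a ≤ m, b ≤ n, c ≤ n the P-positions are
-- those with a ⊕ b ⊕ c = 0 together with (m, n, n). Two facts about n make (m, n, n) fit:
-- every 0 < x < m is a submask of n, so x ⊕ (n − x) = n with 0 < n − x < n, whereas the only
-- y with m ⊕ y = n is n + m > n. Hence (n, n, n) is P when n = 2^j − 1, and otherwise the move
-- (n, n, n) → (2^j, n, n) wins.
module Submission where

open import Defs
open import Data.Bool using (Bool; true; false; _xor_; _∧_)
open import Data.Bool.Properties using (xor-comm; xor-assoc; xor-identityˡ; xor-same; ∧-identityʳ)
open import Data.Fin.Subset using (Subset; _∩_) renaming (⊥ to ∅)
open import Data.Fin.Subset.Properties using (∩-zeroˡ)
open import Data.List using ([]; _∷_)
open import Data.Maybe using (just; nothing)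
open import Data.Nat using (ℕ; zero; suc; _+_; _*_; _^_; _≤_; _<_; _≟_; z≤n; s≤s; ⌊_/2⌋)
open import Data.Nat.Induction using (<-wellFounded)
open import Data.Nat.Properties
open import Data.Nat.Solver using (module +-*-Solver)
open import Data.Product using (∃-syntax; ∃₂; _×_; _,_)
open import Data.Sum using (_⊎_; inj₁; inj₂)
open import Data.Vec using ([]; _∷_; zipWith)
open import Data.Vec.Properties using (zipWith-comm; zipWith-assoc; zipWith-identityˡ)
open import Function using (_∘_)
open import Function.Bundles using (_⇔_; mk⇔)
open import Induction.WellFounded using (Acc; acc)
open import Relation.Binary using (tri<; tri≈; tri>)
open import Relation.Binary.PropositionalEquality
open import Relation.Nullary using (¬_; yes; no; contradiction)
open +-*-Solver using (solve; _:+_; _:*_; _:=_; con)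

bit : Bool → ℕ
bit false = 0
bit true  = 1

odd : ℕ → Bool
odd 0             = false
odd 1             = true
odd (suc (suc n)) = odd n

⟦_⟧ : ∀ {K} → Subset K → ℕ
⟦ [] ⟧     = 0
⟦ b ∷ bs ⟧ = bit b + 2 * ⟦ bs ⟧

-- The digits of n below position K, least significant first, as the set of positions of its
-- 1-bits; higher digits are dropped, hence the bounds n < 2 ^ K in the lemmas below.
bits : (K : ℕ) → ℕ → Subset K
bits zero    n = []
bits (suc K) n = odd n ∷ bits K ⌊ n /2⌋

bit+2*suc : ∀ b q → bit b + 2 * suc q ≡ 2 + (bit b + 2 * q)
bit+2*suc b q = solve 2 (λ b q → b :+ con 2 :* (con 1 :+ q) := con 2 :+ (b :+ con 2 :* q)) refl (bit b) q

bit-odd+2*⌊/2⌋ : ∀ n → bit (odd n) + 2 * ⌊ n /2⌋ ≡ n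
bit-odd+2*⌊/2⌋ 0             = refl
bit-odd+2*⌊/2⌋ 1             = refl
bit-odd+2*⌊/2⌋ (suc (suc n)) = trans (bit+2*suc (odd n) ⌊ n /2⌋) (cong (2 +_) (bit-odd+2*⌊/2⌋ n))

bits-bit+2* : ∀ K b q → bits (suc K) (bit b + 2 * q) ≡ b ∷ bits K q
bits-bit+2* K b q = cong₂ (λ b q → b ∷ bits K q) (odd-bit+2* b q) (⌊bit+2*/2⌋ b q)
  where
  odd-bit+2* : ∀ b q → odd (bit b + 2 * q) ≡ b
  odd-bit+2* false zero    = refl
  odd-bit+2* true  zero    = refl
  odd-bit+2* b     (suc q) = trans (cong odd (bit+2*suc b q)) (odd-bit+2* b q)
  ⌊bit+2*/2⌋ : ∀ b q → ⌊ bit b + 2 * q /2⌋ ≡ q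
  ⌊bit+2*/2⌋ false zero    = refl
  ⌊bit+2*/2⌋ true  zero    = refl
  ⌊bit+2*/2⌋ b     (suc q) = trans (cong ⌊_/2⌋ (bit+2*suc b q)) (cong suc (⌊bit+2*/2⌋ b q))

⌊n/2⌋<2^K : ∀ {K n} → n < 2 ^ suc K → ⌊ n /2⌋ < 2 ^ K
⌊n/2⌋<2^K {K} {n} n< = *-cancelˡ-< 2 ⌊ n /2⌋ (2 ^ K)
  (≤-<-trans (m≤n+m _ (bit (odd n))) (subst (_< 2 ^ suc K) (sym (bit-odd+2*⌊/2⌋ n)) n<))

n<2^n : ∀ n → n < 2 ^ n
n<2^n zero    = s≤s z≤n
n<2^n (suc n) = begin-strict
  suc n          ≤⟨ n<2^n n ⟩
  2 ^ n          <⟨ m<m+n (2 ^ n) (m^n>0 2 n) ⟩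
  2 ^ n + 2 ^ n  ≡⟨ cong (2 ^ n +_) (+-identityʳ (2 ^ n)) ⟨
  2 ^ suc n      ∎
  where open ≤-Reasoning

bits-⟦⟧ : ∀ {K} (v : Subset K) → bits K ⟦ v ⟧ ≡ v
bits-⟦⟧ []       = refl
bits-⟦⟧ {suc K} (b ∷ v) = trans (bits-bit+2* K b ⟦ v ⟧) (cong (b ∷_) (bits-⟦⟧ v))

⟦⟧-bits : ∀ {K n} → n < 2 ^ K → ⟦ bits K n ⟧ ≡ n
⟦⟧-bits {zero}  {zero}  _ = refl
⟦⟧-bits {zero}  {suc n} (s≤s ())
⟦⟧-bits {suc K} {n}     n< =
  trans (cong (λ q → bit (odd n) + 2 * q) (⟦⟧-bits {K} (⌊n/2⌋<2^K {K} n<))) (bit-odd+2*⌊/2⌋ n)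

bits-injective : ∀ {K a b} → a < 2 ^ K → b < 2 ^ K → bits K a ≡ bits K b → a ≡ b
bits-injective {K} a< b< eq = trans (sym (⟦⟧-bits {K} a<)) (trans (cong ⟦_⟧ eq) (⟦⟧-bits {K} b<))

bits-0 : ∀ K → bits K 0 ≡ ∅
bits-0 zero    = refl
bits-0 (suc K) = cong (false ∷_) (bits-0 K)

⟦∅⟧ : ∀ K → ⟦ ∅ {K} ⟧ ≡ 0
⟦∅⟧ zero    = refl
⟦∅⟧ (suc K) = cong (2 *_) (⟦∅⟧ K)

infixl 6 _⊕_

_⊕_ : ∀ {K} → Subset K → Subset K → Subset K
_⊕_ = zipWith _xor_

module _ {K : ℕ} where

  ⊕-comm : (xs ys : Subset K) → xs ⊕ ys ≡ ys ⊕ xs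
  ⊕-comm = zipWith-comm xor-comm

  ⊕-assoc : (xs ys zs : Subset K) → xs ⊕ ys ⊕ zs ≡ xs ⊕ (ys ⊕ zs)
  ⊕-assoc = zipWith-assoc xor-assoc

  ⊕-identityˡ : (xs : Subset K) → ∅ ⊕ xs ≡ xs
  ⊕-identityˡ = zipWith-identityˡ xor-identityˡ

⊕-self : ∀ {K} (xs : Subset K) → xs ⊕ xs ≡ ∅
⊕-self []       = refl
⊕-self (x ∷ xs) = cong₂ _∷_ (xor-same x) (⊕-self xs)

⊕-cancelˡ : ∀ {K} (xs ys : Subset K) → xs ⊕ (xs ⊕ ys) ≡ ys
⊕-cancelˡ xs ys = begin
  xs ⊕ (xs ⊕ ys) ≡⟨ ⊕-assoc xs xs ys ⟨
  xs ⊕ xs ⊕ ys   ≡⟨ cong (_⊕ ys) (⊕-self xs) ⟩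
  ∅ ⊕ ys         ≡⟨ ⊕-identityˡ ys ⟩
  ys             ∎
  where open ≡-Reasoning

⊕-transpose : ∀ {K} {xs ys zs : Subset K} → xs ⊕ ys ≡ zs → xs ⊕ zs ≡ ys
⊕-transpose {xs = xs} {ys} refl = ⊕-cancelˡ xs ys

⟦⟧-⊕-∩ : ∀ {K} (xs ys : Subset K) → ⟦ xs ⊕ ys ⟧ + 2 * ⟦ xs ∩ ys ⟧ ≡ ⟦ xs ⟧ + ⟦ ys ⟧
⟦⟧-⊕-∩ []       []       = refl
⟦⟧-⊕-∩ (x ∷ xs) (y ∷ ys) = begin
  (bit (x xor y) + 2 * ⟦ xs ⊕ ys ⟧) + 2 * (bit (x ∧ y) + 2 * ⟦ xs ∩ ys ⟧)
    ≡⟨ regroup (bit (x xor y)) (bit (x ∧ y)) ⟦ xs ⊕ ys ⟧ ⟦ xs ∩ ys ⟧ ⟩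
  (bit (x xor y) + 2 * bit (x ∧ y)) + 2 * (⟦ xs ⊕ ys ⟧ + 2 * ⟦ xs ∩ ys ⟧)
    ≡⟨ cong₂ (λ l h → l + 2 * h) (half-adder x y) (⟦⟧-⊕-∩ xs ys) ⟩
  (bit x + bit y) + 2 * (⟦ xs ⟧ + ⟦ ys ⟧)
    ≡⟨ pair-up (bit x) (bit y) ⟦ xs ⟧ ⟦ ys ⟧ ⟨
  (bit x + 2 * ⟦ xs ⟧) + (bit y + 2 * ⟦ ys ⟧)
    ∎
  where
  open ≡-Reasoning
  half-adder : ∀ x y → bit (x xor y) + 2 * bit (x ∧ y) ≡ bit x + bit y
  half-adder false false = refl
  half-adder false true  = refl
  half-adder true  false = refl
  half-adder true  true  = refl
  regroup : ∀ a b c d → (a + 2 * c) + 2 * (b + 2 * d) ≡ (a + 2 * b) + 2 * (c + 2 * d)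
  regroup = solve 4 (λ a b c d → (a :+ con 2 :* c) :+ con 2 :* (b :+ con 2 :* d)
                              := (a :+ con 2 :* b) :+ con 2 :* (c :+ con 2 :* d)) refl
  pair-up : ∀ a b c d → (a + 2 * c) + (b + 2 * d) ≡ (a + b) + 2 * (c + d)
  pair-up = solve 4 (λ a b c d → (a :+ con 2 :* c) :+ (b :+ con 2 :* d)
                              := (a :+ b) :+ con 2 :* (c :+ d)) refl

⟦⟧-⊕-disjoint : ∀ {K} (xs ys : Subset K) → xs ∩ ys ≡ ∅ → ⟦ xs ⊕ ys ⟧ ≡ ⟦ xs ⟧ + ⟦ ys ⟧
⟦⟧-⊕-disjoint {K} xs ys disjoint = begin
  ⟦ xs ⊕ ys ⟧                      ≡⟨ +-identityʳ _ ⟨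
  ⟦ xs ⊕ ys ⟧ + 2 * 0              ≡⟨ cong (λ v → ⟦ xs ⊕ ys ⟧ + 2 * v) (trans (cong ⟦_⟧ disjoint) (⟦∅⟧ K)) ⟨
  ⟦ xs ⊕ ys ⟧ + 2 * ⟦ xs ∩ ys ⟧    ≡⟨ ⟦⟧-⊕-∩ xs ys ⟩
  ⟦ xs ⟧ + ⟦ ys ⟧                  ∎
  where open ≡-Reasoning

⟦⟧-⊕-⊆ : ∀ {K} (xs ys : Subset K) → xs ∩ ys ≡ xs → ⟦ xs ⟧ + ⟦ xs ⊕ ys ⟧ ≡ ⟦ ys ⟧
⟦⟧-⊕-⊆ xs ys xs⊆ys = +-cancelʳ-≡ ⟦ xs ⟧ _ _ (begin
  ⟦ xs ⟧ + ⟦ xs ⊕ ys ⟧ + ⟦ xs ⟧        ≡⟨ solve 2 (λ a b → a :+ b :+ a := b :+ con 2 :* a) refl ⟦ xs ⟧ ⟦ xs ⊕ ys ⟧ ⟩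
  ⟦ xs ⊕ ys ⟧ + 2 * ⟦ xs ⟧             ≡⟨ cong (λ v → ⟦ xs ⊕ ys ⟧ + 2 * ⟦ v ⟧) xs⊆ys ⟨
  ⟦ xs ⊕ ys ⟧ + 2 * ⟦ xs ∩ ys ⟧        ≡⟨ ⟦⟧-⊕-∩ xs ys ⟩
  ⟦ xs ⟧ + ⟦ ys ⟧                      ≡⟨ +-comm ⟦ xs ⟧ ⟦ ys ⟧ ⟩
  ⟦ ys ⟧ + ⟦ xs ⟧                      ∎)
  where open ≡-Reasoning

bit+2*-mono-< : ∀ b c {v w} → v < w → bit b + 2 * v < bit c + 2 * w
bit+2*-mono-< b c {v} {w} v<w = begin-strict
  bit b + 2 * v  ≤⟨ +-monoˡ-≤ (2 * v) (bit≤1 b) ⟩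
  1 + 2 * v      <⟨ n<1+n _ ⟩
  2 + 2 * v      ≡⟨ *-suc 2 v ⟨
  2 * suc v      ≤⟨ *-monoʳ-≤ 2 v<w ⟩
  2 * w          ≤⟨ m≤n+m _ (bit c) ⟩
  bit c + 2 * w  ∎
  where
  open ≤-Reasoning
  bit≤1 : ∀ b → bit b ≤ 1
  bit≤1 false = z≤n
  bit≤1 true  = s≤s z≤n

clear-low-bit : ∀ {K} {vs ws : Subset K} → vs ≡ ws → ⟦ false ∷ vs ⟧ < ⟦ true ∷ ws ⟧
clear-low-bit refl = n<1+n _

-- Induction from the least significant digit: if a tail can be decreased, the new low digit is
-- arbitrary; otherwise the tails already cancel and a set low digit gets cleared.
nim-theorem : ∀ {K} (xs ys zs : Subset K) →
  xs ⊕ ys ≡ zs ⊎ ⟦ ys ⊕ zs ⟧ < ⟦ xs ⟧ ⊎ ⟦ xs ⊕ zs ⟧ < ⟦ ys ⟧ ⊎ ⟦ xs ⊕ ys ⟧ < ⟦ zs ⟧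
nim-theorem []       []       []       = inj₁ refl
nim-theorem (x ∷ xs) (y ∷ ys) (z ∷ zs) with nim-theorem xs ys zs
... | inj₂ (inj₁ lt)        = inj₂ (inj₁ (bit+2*-mono-< (y xor z) x lt))
... | inj₂ (inj₂ (inj₁ lt)) = inj₂ (inj₂ (inj₁ (bit+2*-mono-< (x xor z) y lt)))
... | inj₂ (inj₂ (inj₂ lt)) = inj₂ (inj₂ (inj₂ (bit+2*-mono-< (x xor y) z lt)))
... | inj₁ eq with x | y | z
...   | false | false | false = inj₁ (cong (false ∷_) eq)
...   | false | true  | true  = inj₁ (cong (true ∷_) eq)
...   | true  | false | true  = inj₁ (cong (true ∷_) eq)
...   | true  | true  | false = inj₁ (cong (false ∷_) eq)
...   | true  | false | false = inj₂ (inj₁ (clear-low-bit (⊕-transpose (trans (⊕-comm ys xs) eq))))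
...   | true  | true  | true  = inj₂ (inj₁ (clear-low-bit (⊕-transpose (trans (⊕-comm ys xs) eq))))
...   | false | true  | false = inj₂ (inj₂ (inj₁ (clear-low-bit (⊕-transpose eq))))
...   | false | false | true  = inj₂ (inj₂ (inj₂ (clear-low-bit eq)))

NimZero : ℕ → ℕ → ℕ → ℕ → Set
NimZero K a b c = bits K a ⊕ bits K b ≡ bits K c

module _ {K a b c : ℕ} where

  nimZero-swap₁₂ : NimZero K a b c → NimZero K b a c
  nimZero-swap₁₂ = trans (⊕-comm (bits K b) (bits K a))

  nimZero-swap₂₃ : NimZero K a b c → NimZero K a c b
  nimZero-swap₂₃ = ⊕-transpose

nimZero-swap₁₃ : ∀ {K a b c} → NimZero K a b c → NimZero K c b a
nimZero-swap₁₃ = nimZero-swap₁₂ ∘ nimZero-swap₂₃ ∘ nimZero-swap₁₂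

nimZero-unique : ∀ {K a a' b c} → a < 2 ^ K → a' < 2 ^ K →
                 NimZero K a b c → NimZero K a' b c → a ≡ a'
nimZero-unique a< a'< z z' =
  bits-injective a< a'< (trans (sym (nimZero-swap₁₃ z)) (nimZero-swap₁₃ z'))

nimZero-0bb : ∀ {K} b → NimZero K 0 b b
nimZero-0bb {K} b = trans (cong (_⊕ bits K b) (bits-0 K)) (⊕-identityˡ (bits K b))

nimZero-abb⇒a≡0 : ∀ {K a b} → a < 2 ^ K → NimZero K a b b → a ≡ 0
nimZero-abb⇒a≡0 {K} a< z = nimZero-unique a< (m^n>0 2 K) z (nimZero-0bb _)

nimZero-0bc⇒b≡c : ∀ {K b c} → b < 2 ^ K → c < 2 ^ K → NimZero K 0 b c → b ≡ c
nimZero-0bc⇒b≡c b< c< z = nimZero-unique b< c< (nimZero-swap₁₃ (nimZero-0bb _)) (nimZero-swap₁₃ z)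

nim-move : ∀ {K a b c} → a < 2 ^ K → b < 2 ^ K → c < 2 ^ K →
  NimZero K a b c ⊎ (∃[ a' ] a' < a × NimZero K a' b c) ⊎
  (∃[ b' ] b' < b × NimZero K a b' c) ⊎ (∃[ c' ] c' < c × NimZero K a b c')
nim-move {K} {a} {b} {c} a< b< c< with nim-theorem (bits K a) (bits K b) (bits K c)
... | inj₁ z = inj₁ z
... | inj₂ (inj₁ lt) = inj₂ (inj₁ (_ , subst (_ <_) (⟦⟧-bits {K} a<) lt ,
      trans (cong (_⊕ B) (bits-⟦⟧ (B ⊕ C))) (trans (⊕-comm (B ⊕ C) B) (⊕-cancelˡ B C))))
  where
  B C : Subset K
  B = bits K b
  C = bits K c
... | inj₂ (inj₂ (inj₁ lt)) = inj₂ (inj₂ (inj₁ (_ , subst (_ <_) (⟦⟧-bits {K} b<) lt ,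
      trans (cong (A ⊕_) (bits-⟦⟧ (A ⊕ C))) (⊕-cancelˡ A C))))
  where
  A C : Subset K
  A = bits K a
  C = bits K c
... | inj₂ (inj₂ (inj₂ lt)) = inj₂ (inj₂ (inj₂ (_ , subst (_ <_) (⟦⟧-bits {K} c<) lt ,
      sym (bits-⟦⟧ (bits K a ⊕ bits K b)))))

mersenne : ℕ → ℕ
mersenne zero    = 0
mersenne (suc j) = suc (2 * mersenne j)

suc-mersenne : ∀ j → suc (mersenne j) ≡ 2 ^ j
suc-mersenne zero    = refl
suc-mersenne (suc j) = trans (sym (*-suc 2 (mersenne j))) (cong (2 *_) (suc-mersenne j))

mersenne+2^j*0 : ∀ j → mersenne j + 2 ^ j * 0 ≡ mersenne j
mersenne+2^j*0 j = trans (cong (mersenne j +_) (*-zeroʳ (2 ^ j))) (+-identityʳ (mersenne j))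

mersenne-step : ∀ j t → mersenne (suc j) + 2 ^ suc j * t ≡ bit true + 2 * (mersenne j + 2 ^ j * t)
mersenne-step j t = solve 3 (λ M P t → con 1 :+ con 2 :* M :+ (con 2 :* P) :* t
                                   := con 1 :+ con 2 :* (M :+ P :* t)) refl (mersenne j) (2 ^ j) t

⟦⟧-trailing-ones : ∀ {K} (v : Subset K) → ∃₂ λ j u → ⟦ v ⟧ ≡ mersenne j + 2 ^ j * (2 * u)
⟦⟧-trailing-ones []          = 0 , 0 , refl
⟦⟧-trailing-ones (false ∷ v) = 0 , ⟦ v ⟧ , sym (*-identityˡ (2 * ⟦ v ⟧))
⟦⟧-trailing-ones (true ∷ v) with ⟦⟧-trailing-ones v
... | j , u , eq = suc j , u , trans (cong (λ w → 1 + 2 * w) eq) (sym (mersenne-step j (2 * u)))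

trailing-ones : ∀ n → ∃₂ λ j u → n ≡ mersenne j + 2 ^ j * (2 * u)
trailing-ones n with ⟦⟧-trailing-ones (bits n n)
... | j , u , eq = j , u , trans (sym (⟦⟧-bits {n} (n<2^n n))) eq

bits-low-⊆ : ∀ K j t {x} → x < 2 ^ j → bits K x ∩ bits K (mersenne j + 2 ^ j * t) ≡ bits K x
bits-low-⊆ K       zero    t {zero}  _  = trans (cong (_∩ bits K _) (bits-0 K)) (trans (∩-zeroˡ _) (sym (bits-0 K)))
bits-low-⊆ K       zero    t {suc x} (s≤s ())
bits-low-⊆ zero    (suc j) t         _  = refl
bits-low-⊆ (suc K) (suc j) t {x}     x< = begin
  bits (suc K) x ∩ bits (suc K) (mersenne (suc j) + 2 ^ suc j * t)
    ≡⟨ cong (bits (suc K) x ∩_) (trans (cong (bits (suc K)) (mersenne-step j t)) (bits-bit+2* K true _)) ⟩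
  (odd x ∷ bits K ⌊ x /2⌋) ∩ (true ∷ bits K (mersenne j + 2 ^ j * t))
    ≡⟨ cong₂ _∷_ (∧-identityʳ (odd x)) (bits-low-⊆ K j t (⌊n/2⌋<2^K {j} x<)) ⟩
  odd x ∷ bits K ⌊ x /2⌋
    ∎
  where open ≡-Reasoning

bits-gap-disjoint : ∀ K j t → bits K (2 ^ j) ∩ bits K (mersenne j + 2 ^ j * (2 * t)) ≡ ∅
bits-gap-disjoint zero    j       t = refl
bits-gap-disjoint (suc K) zero    t = begin
  (true ∷ bits K 0) ∩ bits (suc K) (1 * (2 * t))  ≡⟨ cong (λ w → (true ∷ bits K 0) ∩ bits (suc K) w) (*-identityˡ (2 * t)) ⟩
  (true ∷ bits K 0) ∩ bits (suc K) (2 * t)        ≡⟨ cong ((true ∷ bits K 0) ∩_) (bits-bit+2* K false t) ⟩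
  false ∷ (bits K 0 ∩ bits K t)                    ≡⟨ cong (λ w → false ∷ (w ∩ bits K t)) (bits-0 K) ⟩
  false ∷ (∅ ∩ bits K t)                           ≡⟨ cong (false ∷_) (∩-zeroˡ (bits K t)) ⟩
  ∅                                                ∎
  where open ≡-Reasoning
bits-gap-disjoint (suc K) (suc j) t = begin
  bits (suc K) (2 * 2 ^ j) ∩ bits (suc K) (mersenne (suc j) + 2 ^ suc j * (2 * t))
    ≡⟨ cong₂ _∩_ (bits-bit+2* K false (2 ^ j))
                 (trans (cong (bits (suc K)) (mersenne-step j (2 * t))) (bits-bit+2* K true _)) ⟩
  false ∷ (bits K (2 ^ j) ∩ bits K (mersenne j + 2 ^ j * (2 * t)))
    ≡⟨ cong (false ∷_) (bits-gap-disjoint K j t) ⟩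
  ∅ ∎
  where open ≡-Reasoning

Partner : ℕ → ℕ → ℕ → Set
Partner K n x = ∃[ y ] 1 ≤ y × y < n × NimZero K x y n

low-bits-partner : ∀ {K} j t {n x} → n ≡ mersenne j + 2 ^ j * t → n < 2 ^ K →
                   1 ≤ x → x < 2 ^ j → x < n → Partner K n x
low-bits-partner {K} j t {n} {x} n≡ n< 1≤x x<2^j x<n = y , 1≤y , y<n , nimZero
  where
  X N : Subset K
  X = bits K x
  N = bits K n
  y : ℕ
  y = ⟦ X ⊕ N ⟧
  X⊆N : X ∩ N ≡ X
  X⊆N = subst (λ n → X ∩ bits K n ≡ X) (sym n≡) (bits-low-⊆ K j t x<2^j)
  x+y≡n : x + y ≡ n
  x+y≡n = begin
    x + y       ≡⟨ cong (_+ y) (⟦⟧-bits {K} (<-trans x<n n<)) ⟨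
    ⟦ X ⟧ + y   ≡⟨ ⟦⟧-⊕-⊆ X N X⊆N ⟩
    ⟦ N ⟧       ≡⟨ ⟦⟧-bits {K} n< ⟩
    n           ∎
    where open ≡-Reasoning
  1≤y : 1 ≤ y
  1≤y = n≢0⇒n>0 λ y≡0 → <⇒≢ x<n (trans (sym (+-identityʳ x)) (subst (λ y → x + y ≡ n) y≡0 x+y≡n))
  y<n : y < n
  y<n = subst (y <_) (trans (+-comm y x) x+y≡n) (m<m+n y 1≤x)
  nimZero : NimZero K x y n
  nimZero = trans (cong (X ⊕_) (bits-⟦⟧ (X ⊕ N))) (⊕-cancelˡ X N)

gap-bit-partner≡ : ∀ {K} j t {n y} → n ≡ mersenne j + 2 ^ j * (2 * t) →
                   2 ^ j < 2 ^ K → n < 2 ^ K → y < 2 ^ K → NimZero K (2 ^ j) y n → y ≡ 2 ^ j + n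
gap-bit-partner≡ {K} j t {n} {y} n≡ 2^j< n< y< z = begin
  y              ≡⟨ ⟦⟧-bits {K} y< ⟨
  ⟦ bits K y ⟧   ≡⟨ cong ⟦_⟧ (⊕-transpose z) ⟨
  ⟦ M ⊕ N ⟧      ≡⟨ ⟦⟧-⊕-disjoint M N M∩N≡∅ ⟩
  ⟦ M ⟧ + ⟦ N ⟧  ≡⟨ cong₂ _+_ (⟦⟧-bits {K} 2^j<) (⟦⟧-bits {K} n<) ⟩
  2 ^ j + n      ∎
  where
  open ≡-Reasoning
  M N : Subset K
  M = bits K (2 ^ j)
  N = bits K n
  M∩N≡∅ : M ∩ N ≡ ∅
  M∩N≡∅ = subst (λ n → M ∩ bits K n ≡ ∅) (sym n≡) (bits-gap-disjoint K j t)

2^j<mersenne+2^j*2[1+u] : ∀ j u → 2 ^ j < mersenne j + 2 ^ j * (2 * suc u)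
2^j<mersenne+2^j*2[1+u] j u = begin-strict
  2 ^ j                          <⟨ m<m*n (2 ^ j) 2 {{m^n≢0 2 j}} (s≤s (s≤s z≤n)) ⟩
  2 ^ j * 2                      ≤⟨ *-monoʳ-≤ (2 ^ j) (m≤m*n 2 (suc u)) ⟩
  2 ^ j * (2 * suc u)            ≤⟨ m≤n+m _ (mersenne j) ⟩
  mersenne j + 2 ^ j * (2 * suc u) ∎
  where open ≤-Reasoning

leaf : ℕ → Tree
leaf s = node s []

path₂ : ℕ → ℕ → Pos
path₂ o y = just (node o (leaf y ∷ []))

path₃ : ℕ → ℕ → ℕ → Pos
path₃ o x y = just (node o (leaf x ∷ leaf y ∷ []))

record Outcome (p : Pos) (S : Set) : Set where
  field
    P-if : S → IsP p
    N-if : ¬ S → IsN p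

IsP⇒¬IsN : ∀ {p} → IsP p → ¬ IsN p
IsP⇒¬IsN (allN next) (someP q move q-P) = IsP⇒¬IsN q-P (next q move)

vertex-N : ∀ {s} → IsN (just (leaf s))
vertex-N = someP nothing root-delete0 (allN λ _ ())

shrink-first : ∀ {o s s' ts} → 1 ≤ s' → s' < s →
  Move (just (node o (leaf s ∷ ts))) (just (node o (leaf s' ∷ ts)))
shrink-first 1≤s' s'<s = inner (here (leaf-shrink 1≤s' s'<s))

shrink-second : ∀ {o s s' t ts} → 1 ≤ s' → s' < s →
  Move (just (node o (t ∷ leaf s ∷ ts))) (just (node o (t ∷ leaf s' ∷ ts)))
shrink-second 1≤s' s'<s = inner (there (here (leaf-shrink 1≤s' s'<s)))

shrink-third : ∀ {o s s' t u ts} → 1 ≤ s' → s' < s →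
  Move (just (node o (t ∷ u ∷ leaf s ∷ ts))) (just (node o (t ∷ u ∷ leaf s' ∷ ts)))
shrink-third 1≤s' s'<s = inner (there (there (here (leaf-shrink 1≤s' s'<s))))

delete-first : ∀ {o s ts} → Move (just (node o (leaf s ∷ ts))) (just (node o ts))
delete-first = inner (here-del leaf-delete)

delete-second : ∀ {o s t ts} → Move (just (node o (t ∷ leaf s ∷ ts))) (just (node o (t ∷ ts)))
delete-second = inner (there (here-del leaf-delete))

delete-third : ∀ {o s t u ts} → Move (just (node o (t ∷ u ∷ leaf s ∷ ts))) (just (node o (t ∷ u ∷ ts)))
delete-third = inner (there (there (here-del leaf-delete)))

path₂-P-intro : ∀ {o y} →
  (∀ {o'} → 1 ≤ o' → o' < o → IsN (path₂ o' y)) →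
  (∀ {y'} → 1 ≤ y' → y' < y → IsN (path₂ o y')) →
  IsP (path₂ o y)
path₂-P-intro root-N leaf-N = allN λ where
  _ (inner (here (leaf-shrink p q))) → leaf-N p q
  _ (inner (here (deeper ())))
  _ (inner (here-del leaf-delete))   → vertex-N
  _ (inner (there ()))
  _ (root-shrink1 p q)               → root-N p q
  _ root-delete1                     → vertex-N

path₃-P-intro : ∀ {o x y} →
  (∀ {x'} → 1 ≤ x' → x' < x → IsN (path₃ o x' y)) →
  (∀ {y'} → 1 ≤ y' → y' < y → IsN (path₃ o x y')) →
  IsN (path₂ o y) → IsN (path₂ o x) →
  IsP (path₃ o x y)
path₃-P-intro first-N second-N without-first without-second = allN λ where
  _ (inner (here (leaf-shrink p q)))         → first-N p q
  _ (inner (here (deeper ())))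
  _ (inner (here-del leaf-delete))           → without-first
  _ (inner (there (here (leaf-shrink p q)))) → second-N p q
  _ (inner (there (here (deeper ()))))
  _ (inner (there (here-del leaf-delete)))   → without-second
  _ (inner (there (there ())))

tripod-P-intro : ∀ {o a b c} →
  (∀ {a'} → 1 ≤ a' → a' < a → IsN (tripod o a' b c)) →
  (∀ {b'} → 1 ≤ b' → b' < b → IsN (tripod o a b' c)) →
  (∀ {c'} → 1 ≤ c' → c' < c → IsN (tripod o a b c')) →
  IsN (path₃ o b c) → IsN (path₃ o a c) → IsN (path₃ o a b) →
  IsP (tripod o a b c)
tripod-P-intro first-N second-N third-N without-first without-second without-third = allN λ where
  _ (inner (here (leaf-shrink p q)))                 → first-N p q
  _ (inner (here (deeper ())))
  _ (inner (here-del leaf-delete))                   → without-first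
  _ (inner (there (here (leaf-shrink p q))))         → second-N p q
  _ (inner (there (here (deeper ()))))
  _ (inner (there (here-del leaf-delete)))           → without-second
  _ (inner (there (there (here (leaf-shrink p q))))) → third-N p q
  _ (inner (there (there (here (deeper ())))))
  _ (inner (there (there (here-del leaf-delete))))   → without-third
  _ (inner (there (there (there ()))))

path₂-outcome : ∀ {o y} → Acc _<_ (o + y) → 1 ≤ o → 1 ≤ y → Outcome (path₂ o y) (o ≡ y)
path₂-outcome {o} {y} (acc smaller) 1≤o 1≤y = record { P-if = equal⇒P ; N-if = unequal⇒N }
  where
  IH : ∀ {o' y'} → o' + y' < o + y → 1 ≤ o' → 1 ≤ y' → Outcome (path₂ o' y') (o' ≡ y')
  IH lt = path₂-outcome (smaller lt)
  equal⇒P : o ≡ y → IsP (path₂ o y)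
  equal⇒P refl = path₂-P-intro
    (λ 1≤o' o'<o → Outcome.N-if (IH (+-monoˡ-< o o'<o) 1≤o' 1≤o) (<⇒≢ o'<o))
    (λ 1≤y' y'<o → Outcome.N-if (IH (+-monoʳ-< o y'<o) 1≤o 1≤y') (<⇒≢ y'<o ∘ sym))
  unequal⇒N : o ≢ y → IsN (path₂ o y)
  unequal⇒N o≢y with <-cmp o y
  ... | tri< o<y _ _ = someP _ (shrink-first 1≤o o<y) (Outcome.P-if (IH (+-monoʳ-< o o<y) 1≤o 1≤o) refl)
  ... | tri≈ _ o≡y _ = contradiction o≡y o≢y
  ... | tri> _ _ y<o = someP _ (root-shrink1 1≤y y<o) (Outcome.P-if (IH (+-monoˡ-< y y<o) 1≤y 1≤y) refl)

path₂-P : ∀ {o} → 1 ≤ o → IsP (path₂ o o)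
path₂-P 1≤o = Outcome.P-if (path₂-outcome (<-wellFounded _) 1≤o 1≤o) refl

path₂-N : ∀ {o y} → 1 ≤ o → 1 ≤ y → o ≢ y → IsN (path₂ o y)
path₂-N 1≤o 1≤y = Outcome.N-if (path₂-outcome (<-wellFounded _) 1≤o 1≤y)

path₃-outcome : ∀ {o x y} → Acc _<_ (x + y) → 1 ≤ o → 1 ≤ x → 1 ≤ y →
                Outcome (path₃ o x y) (x ≡ y × x ≢ o)
path₃-outcome {o} {x} {y} (acc smaller) 1≤o 1≤x 1≤y = record { P-if = twins⇒P ; N-if = ¬twins⇒N }
  where
  IH : ∀ {x' y'} → x' + y' < x + y → 1 ≤ x' → 1 ≤ y' → Outcome (path₃ o x' y') (x' ≡ y' × x' ≢ o)
  IH lt = path₃-outcome (smaller lt) 1≤o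
  twins⇒P : x ≡ y × x ≢ o → IsP (path₃ o x y)
  twins⇒P (refl , x≢o) = path₃-P-intro
    (λ 1≤x' x'<x → Outcome.N-if (IH (+-monoˡ-< x x'<x) 1≤x' 1≤x) (λ (x'≡x , _) → <⇒≢ x'<x x'≡x))
    (λ 1≤y' y'<x → Outcome.N-if (IH (+-monoʳ-< x y'<x) 1≤x 1≤y') (λ (x≡y' , _) → <⇒≢ y'<x (sym x≡y')))
    (path₂-N 1≤o 1≤x (x≢o ∘ sym))
    (path₂-N 1≤o 1≤x (x≢o ∘ sym))
  ¬twins⇒N : ¬ (x ≡ y × x ≢ o) → IsN (path₃ o x y)
  ¬twins⇒N ¬twins with <-cmp x y
  ... | tri≈ _ refl _ with x ≟ o
  ...   | yes refl = someP _ delete-first (path₂-P 1≤o)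
  ...   | no x≢o   = contradiction (refl , x≢o) ¬twins
  ¬twins⇒N ¬twins | tri< x<y _ _ with x ≟ o
  ...   | yes refl = someP _ delete-second (path₂-P 1≤o)
  ...   | no x≢o   = someP _ (shrink-second 1≤x x<y)
                       (Outcome.P-if (IH (+-monoʳ-< x x<y) 1≤x 1≤x) (refl , x≢o))
  ¬twins⇒N ¬twins | tri> _ _ y<x with y ≟ o
  ...   | yes refl = someP _ delete-first (path₂-P 1≤o)
  ...   | no y≢o   = someP _ (shrink-first 1≤y y<x)
                       (Outcome.P-if (IH (+-monoˡ-< y y<x) 1≤y 1≤y) (refl , y≢o))

path₃-P : ∀ {o x} → 1 ≤ o → 1 ≤ x → x ≢ o → IsP (path₃ o x x)
path₃-P 1≤o 1≤x x≢o = Outcome.P-if (path₃-outcome (<-wellFounded _) 1≤o 1≤x 1≤x) (refl , x≢o)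

path₃-N : ∀ {o x y} → 1 ≤ o → 1 ≤ x → 1 ≤ y → (x ≡ y → x ≡ o) → IsN (path₃ o x y)
path₃-N 1≤o 1≤x 1≤y twins⇒o = Outcome.N-if (path₃-outcome (<-wellFounded _) 1≤o 1≤x 1≤y)
  (λ (x≡y , x≢o) → x≢o (twins⇒o x≡y))

module SpecialTripod {K n m : ℕ} (n<2^K : n < 2 ^ K) (1≤m : 1 ≤ m) (m≤n : m ≤ n)
  (partner : ∀ {x} → 1 ≤ x → x < m → Partner K n x) (m-unpartnered : ¬ Partner K n m) where

  1≤n : 1 ≤ n
  1≤n = ≤-trans 1≤m m≤n

  <2^K : ∀ {a} → a ≤ n → a < 2 ^ K
  <2^K a≤n = ≤-<-trans a≤n n<2^K

  record InRange (a b c : ℕ) : Set where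
    constructor in-range
    field
      1≤a : 1 ≤ a
      a≤m : a ≤ m
      1≤b : 1 ≤ b
      b≤n : b ≤ n
      1≤c : 1 ≤ c
      c≤n : c ≤ n

    a≤n : a ≤ n
    a≤n = ≤-trans a≤m m≤n

  Target : ℕ → ℕ → ℕ → Set
  Target a b c = NimZero K a b c ⊎ (a ≡ m × b ≡ n × c ≡ n)

  module _ {a b c} (r : InRange a b c) where
    open InRange r

    shrink-first-¬Target : Target a b c → ∀ {a'} → 1 ≤ a' → a' < a → ¬ Target a' b c
    shrink-first-¬Target (inj₁ z) _ a'<a (inj₁ z') =
      <⇒≢ a'<a (nimZero-unique (<2^K (≤-trans (<⇒≤ a'<a) a≤n)) (<2^K a≤n) z' z)
    shrink-first-¬Target (inj₁ z) _ _ (inj₂ (_ , refl , refl)) = n>0⇒n≢0 1≤a (nimZero-abb⇒a≡0 (<2^K a≤n) z)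
    shrink-first-¬Target (inj₂ (refl , refl , refl)) 1≤a' a'<m (inj₁ z') =
      n>0⇒n≢0 1≤a' (nimZero-abb⇒a≡0 (<2^K (≤-trans (<⇒≤ a'<m) m≤n)) z')
    shrink-first-¬Target (inj₂ (refl , _ , _)) _ a'<m (inj₂ (refl , _ , _)) = <-irrefl refl a'<m

    shrink-second-¬Target : Target a b c → ∀ {b'} → 1 ≤ b' → b' < b → ¬ Target a b' c
    shrink-second-¬Target _ _ b'<b (inj₂ (_ , refl , _)) = <⇒≱ b'<b b≤n
    shrink-second-¬Target (inj₁ z) _ b'<b (inj₁ z') =
      <⇒≢ b'<b (nimZero-unique (<2^K (≤-trans (<⇒≤ b'<b) b≤n)) (<2^K b≤n) (nimZero-swap₁₂ z') (nimZero-swap₁₂ z))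
    shrink-second-¬Target (inj₂ (refl , refl , refl)) 1≤b' b'<n (inj₁ z') = m-unpartnered (_ , 1≤b' , b'<n , z')

    shrink-third-¬Target : Target a b c → ∀ {c'} → 1 ≤ c' → c' < c → ¬ Target a b c'
    shrink-third-¬Target _ _ c'<c (inj₂ (_ , _ , refl)) = <⇒≱ c'<c c≤n
    shrink-third-¬Target (inj₁ z) _ c'<c (inj₁ z') =
      <⇒≢ c'<c (nimZero-unique (<2^K (≤-trans (<⇒≤ c'<c) c≤n)) (<2^K c≤n) (nimZero-swap₁₃ z') (nimZero-swap₁₃ z))
    shrink-third-¬Target (inj₂ (refl , refl , refl)) 1≤c' c'<n (inj₁ z') =
      m-unpartnered (_ , 1≤c' , c'<n , nimZero-swap₂₃ z')

    Target-twins : Target a b c → (b ≡ c → b ≡ n) × (a ≡ c → a ≡ n) × (a ≡ b → a ≡ n)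
    Target-twins (inj₁ z) =
      (λ { refl → contradiction (nimZero-abb⇒a≡0 (<2^K a≤n) z) (n>0⇒n≢0 1≤a) }) ,
      (λ { refl → contradiction (nimZero-abb⇒a≡0 (<2^K b≤n) (nimZero-swap₁₂ z)) (n>0⇒n≢0 1≤b) }) ,
      (λ { refl → contradiction (nimZero-abb⇒a≡0 (<2^K c≤n) (nimZero-swap₁₃ z)) (n>0⇒n≢0 1≤c) })
    Target-twins (inj₂ (_ , b≡n , c≡n)) = (λ _ → b≡n) , (λ a≡c → trans a≡c c≡n) , (λ a≡b → trans a≡b b≡n)

  outcome : ∀ {a b c} → Acc _<_ (a + b + c) → InRange a b c → Outcome (tripod n a b c) (Target a b c)
  outcome {a} {b} {c} (acc smaller) r = record { P-if = Target⇒P ; N-if = ¬Target⇒N }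
    where
    open InRange r

    IH₁ : ∀ {a'} → 1 ≤ a' → a' < a → Outcome (tripod n a' b c) (Target a' b c)
    IH₁ 1≤a' a'<a = outcome (smaller (+-monoˡ-< c (+-monoˡ-< b a'<a)))
      (in-range 1≤a' (≤-trans (<⇒≤ a'<a) a≤m) 1≤b b≤n 1≤c c≤n)
    IH₂ : ∀ {b'} → 1 ≤ b' → b' < b → Outcome (tripod n a b' c) (Target a b' c)
    IH₂ 1≤b' b'<b = outcome (smaller (+-monoˡ-< c (+-monoʳ-< a b'<b)))
      (in-range 1≤a a≤m 1≤b' (≤-trans (<⇒≤ b'<b) b≤n) 1≤c c≤n)
    IH₃ : ∀ {c'} → 1 ≤ c' → c' < c → Outcome (tripod n a b c') (Target a b c')
    IH₃ 1≤c' c'<c = outcome (smaller (+-monoʳ-< (a + b) c'<c))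
      (in-range 1≤a a≤m 1≤b b≤n 1≤c' (≤-trans (<⇒≤ c'<c) c≤n))

    Target⇒P : Target a b c → IsP (tripod n a b c)
    Target⇒P t with Target-twins r t
    ... | twins₂₃ , twins₁₃ , twins₁₂ = tripod-P-intro
      (λ p q → Outcome.N-if (IH₁ p q) (shrink-first-¬Target r t p q))
      (λ p q → Outcome.N-if (IH₂ p q) (shrink-second-¬Target r t p q))
      (λ p q → Outcome.N-if (IH₃ p q) (shrink-third-¬Target r t p q))
      (path₃-N 1≤n 1≤b 1≤c twins₂₃)
      (path₃-N 1≤n 1≤a 1≤c twins₁₃)
      (path₃-N 1≤n 1≤a 1≤b twins₁₂)

    n≤a⇒m≡n : n ≤ a → m ≡ n
    n≤a⇒m≡n n≤a = ≤-antisym m≤n (≤-trans n≤a a≤m)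

    ¬Target⇒N : ¬ Target a b c → IsN (tripod n a b c)
    ¬Target⇒N ¬t with b ≟ c | a ≟ c | a ≟ b
    ... | yes refl | _ | _ with b ≟ n
    ...   | no b≢n   = someP _ delete-first (path₃-P 1≤n 1≤b b≢n)
    ...   | yes refl with partner 1≤a (≤∧≢⇒< a≤m λ a≡m → ¬t (inj₂ (a≡m , refl , refl)))
    ...     | y , 1≤y , y<n , z = someP _ (shrink-second 1≤y y<n) (Outcome.P-if (IH₂ 1≤y y<n) (inj₁ z))
    ¬Target⇒N ¬t | no b≢c | yes refl | _ with a ≟ n
    ...   | no a≢n   = someP _ delete-second (path₃-P 1≤n 1≤a a≢n)
    ...   | yes refl with partner 1≤b (subst (b <_) (sym (n≤a⇒m≡n ≤-refl)) (≤∧≢⇒< b≤n b≢c))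
    ...     | y , 1≤y , y<n , z =
      someP _ (shrink-first 1≤y y<n) (Outcome.P-if (IH₁ 1≤y y<n) (inj₁ (nimZero-swap₁₂ z)))
    ¬Target⇒N ¬t | no b≢c | no a≢c | yes refl with a ≟ n
    ...   | no a≢n   = someP _ delete-third (path₃-P 1≤n 1≤a a≢n)
    ...   | yes refl with partner 1≤c (subst (c <_) (sym (n≤a⇒m≡n ≤-refl)) (≤∧≢⇒< c≤n (a≢c ∘ sym)))
    ...     | y , 1≤y , y<n , z =
      someP _ (shrink-first 1≤y y<n) (Outcome.P-if (IH₁ 1≤y y<n) (inj₁ (nimZero-swap₂₃ (nimZero-swap₁₂ z))))
    ¬Target⇒N ¬t | no b≢c | no a≢c | no a≢b with nim-move (<2^K a≤n) (<2^K b≤n) (<2^K c≤n)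
    ... | inj₁ z = contradiction (inj₁ z) ¬t
    ... | inj₂ (inj₁ (a' , a'<a , z)) = someP _ (shrink-first 1≤a' a'<a) (Outcome.P-if (IH₁ 1≤a' a'<a) (inj₁ z))
      where
      1≤a' : 1 ≤ a'
      1≤a' = n≢0⇒n>0 λ { refl → b≢c (nimZero-0bc⇒b≡c (<2^K b≤n) (<2^K c≤n) z) }
    ... | inj₂ (inj₂ (inj₁ (b' , b'<b , z))) = someP _ (shrink-second 1≤b' b'<b) (Outcome.P-if (IH₂ 1≤b' b'<b) (inj₁ z))
      where
      1≤b' : 1 ≤ b'
      1≤b' = n≢0⇒n>0 λ { refl → a≢c (nimZero-0bc⇒b≡c (<2^K a≤n) (<2^K c≤n) (nimZero-swap₁₂ z)) }
    ... | inj₂ (inj₂ (inj₂ (c' , c'<c , z))) = someP _ (shrink-third 1≤c' c'<c) (Outcome.P-if (IH₃ 1≤c' c'<c) (inj₁ z))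
      where
      1≤c' : 1 ≤ c'
      1≤c' = n≢0⇒n>0 λ { refl → a≢b (sym (nimZero-0bc⇒b≡c (<2^K b≤n) (<2^K a≤n) (nimZero-swap₁₃ z))) }

  special-P : IsP (tripod n m n n)
  special-P = Outcome.P-if (outcome (<-wellFounded _) range) (inj₂ (refl , refl , refl))
    where
    range : InRange m n n
    range = in-range 1≤m ≤-refl 1≤n ≤-refl 1≤n ≤-refl

mersenne-tripod-P : ∀ {n} k → 1 ≤ n → suc n ≡ 2 ^ k → IsP (tripod n n n n)
mersenne-tripod-P {n} k 1≤n 1+n≡2^k = SpecialTripod.special-P (n<2^n n) 1≤n ≤-refl partner unpartnered
  where
  n≡ : n ≡ mersenne k + 2 ^ k * 0
  n≡ = trans (suc-injective (trans 1+n≡2^k (sym (suc-mersenne k)))) (sym (mersenne+2^j*0 k))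
  partner : ∀ {x} → 1 ≤ x → x < n → Partner n n x
  partner 1≤x x<n = low-bits-partner k 0 n≡ (n<2^n n) 1≤x (<-trans x<n (subst (n <_) 1+n≡2^k (n<1+n n))) x<n
  unpartnered : ¬ Partner n n n
  unpartnered (y , 1≤y , y<n , z) = n>0⇒n≢0 1≤y (nimZero-abb⇒a≡0 (<-trans y<n (n<2^n n)) (nimZero-swap₁₂ z))

non-mersenne-tripod-N : ∀ {n} j u → n ≡ mersenne j + 2 ^ j * (2 * suc u) → IsN (tripod n n n n)
non-mersenne-tripod-N {n} j u n≡ = someP _ (shrink-first (m^n>0 2 j) 2^j<n)
  (SpecialTripod.special-P (n<2^n n) (m^n>0 2 j) (<⇒≤ 2^j<n) partner unpartnered)
  where
  2^j<n : 2 ^ j < n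
  2^j<n = subst (2 ^ j <_) (sym n≡) (2^j<mersenne+2^j*2[1+u] j u)
  partner : ∀ {x} → 1 ≤ x → x < 2 ^ j → Partner n n x
  partner 1≤x x<2^j = low-bits-partner j (2 * suc u) n≡ (n<2^n n) 1≤x x<2^j (<-trans x<2^j 2^j<n)
  unpartnered : ¬ Partner n n (2 ^ j)
  unpartnered (y , 1≤y , y<n , z) = <⇒≱ y<n (subst (n ≤_) (sym y≡2^j+n) (m≤n+m n (2 ^ j)))
    where
    y≡2^j+n : y ≡ 2 ^ j + n
    y≡2^j+n = gap-bit-partner≡ j (suc u) n≡ (<-trans 2^j<n (n<2^n n)) (n<2^n n) (<-trans y<n (n<2^n n)) z

mainTheorem10 : (n : ℕ) → 1 ≤ n →
    (IsP (tripod n n n n) ⇔ (∃[ k ] suc n ≡ 2 ^ k))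
mainTheorem10 n 1≤n = mk⇔ P⇒power-of-two (λ (k , 1+n≡2^k) → mersenne-tripod-P k 1≤n 1+n≡2^k)
  where
  P⇒power-of-two : IsP (tripod n n n n) → ∃[ k ] suc n ≡ 2 ^ k
  P⇒power-of-two n-P with trailing-ones n
  ... | j , zero  , n≡ = j , trans (cong suc (trans n≡ (mersenne+2^j*0 j))) (suc-mersenne j)
  ... | j , suc u , n≡ = contradiction (non-mersenne-tripod-N j u n≡) (IsP⇒¬IsN n-P)
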